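{- Let $p$ be a prime and $S$ an association scheme on a finite set $X$ with $O^\vartheta(S)\subseteq O_\vartheta(S)$. If $p\nmid|X|$, then $S=\langle S_{p'}\rangle$; in particular, $S$ is the unique closed subset of $S$ containing $S_{p'}$.
   Context: $S=\{R_0,\dots,R_d\}$ is an association scheme on $X$ with diagonal $R_0$, transposes $R_{i^*}$, intersection numbers $p_{ij}^k$, valencies $k_i=p_{ii^*}^0$. $S_{p'}=\{R_i\in S:p\nmid k_i\}$. For nonempty $U,V\subseteq S$, $UV=\{R_k:\exists R_u\in U,R_v\in V,\ p_{uv}^k>0\}$. A nonempty $T\subseteq S$ is closed if $T^*T\subseteq T$ ($T^*=\{R_{i^*}:R_i\in T\}$), strongly normal if also $R_{i^*}TR_i\subseteq T$ for all $i$. $\langle H\rangle$ is the intersection of all closed subsets containing $H$. $O_\vartheta(S)=\{R_i:k_i=1\}$; $O^\vartheta(S)$ is the intersection of all strongly normal closed subsets. -}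

module Defs where

open import Data.Nat using (ℕ; zero; suc; _+_; _<_)
open import Data.Nat.Divisibility using (_∣_)
open import Data.Bool using (Bool; true; false; if_then_else_; _∧_)
open import Data.Fin using (Fin; _≟_)
import Data.Fin as F
open import Data.Fin.Subset using (Subset; _∈_; Nonempty)
open import Data.Product using (_×_; ∃; ∃-syntax)
open import Relation.Nullary using (¬_)
open import Relation.Nullary.Decidable using (⌊_⌋)
open import Relation.Binary.PropositionalEquality using (_≡_)

count : ∀ {n} → (Fin n → Bool) → ℕ
count {zero} f = 0
count {suc n} f = (if f F.zero then 1 else 0) + count (λ z → f (F.suc z))

-- An association scheme S = {R_0,…,R_d} on X = Fin n.
-- rel x y = i  means  (x , y) ∈ R_i  (so the R_i partition X × X).
record AssocScheme (n d : ℕ) : Set where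
  field
    rel      : Fin n → Fin n → Fin (suc d)
    nonempty : ∀ i → ∃[ x ] ∃[ y ] rel x y ≡ i
    diagonal : ∀ x y → rel x y ≡ F.zero → x ≡ y
    diagonal′ : ∀ x → rel x x ≡ F.zero
    tr       : Fin (suc d) → Fin (suc d)
    tr-spec  : ∀ i x y → rel x y ≡ i → rel y x ≡ tr i
    pn       : Fin (suc d) → Fin (suc d) → Fin (suc d) → ℕ
    pn-spec  : ∀ i j k x y → rel x y ≡ k →
               count (λ z → ⌊ rel x z ≟ i ⌋ ∧ ⌊ rel z y ≟ j ⌋) ≡ pn i j k

module _ {n d : ℕ} (S : AssocScheme n d) where
  open AssocScheme S

  valency : Fin (suc d) → ℕ
  valency i = pn i (tr i) F.zero

  InSp′ : ℕ → Fin (suc d) → Set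
  InSp′ p i = ¬ (p ∣ valency i)

  Closed : Subset (suc d) → Set
  Closed T = Nonempty T ×
    (∀ i j k → i ∈ T → j ∈ T → 0 < pn (tr i) j k → k ∈ T)

  StronglyNormal : Subset (suc d) → Set
  StronglyNormal T = Closed T ×
    (∀ i t m k → t ∈ T → 0 < pn (tr i) t m → 0 < pn m i k → k ∈ T)

  InGenerated : (Fin (suc d) → Set) → Fin (suc d) → Set
  InGenerated H k = ∀ T → Closed T → (∀ i → H i → i ∈ T) → k ∈ T

  -- membership in O^θ(S) = intersection of all strongly normal closed subsets
  InOUpper : Fin (suc d) → Set
  InOUpper k = ∀ T → StronglyNormal T → k ∈ T

  -- membership in O_θ(S) = { R_i : k_i = 1 }
  InOLower : Fin (suc d) → Set
  InOLower i = valency i ≡ 1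

-- The hypothesis O^θ(S) ⊆ O_θ(S) forces every valency to divide |X|.  Indeed R_i R_{i*}
-- lies in every strongly normal closed subset, hence consists of thin relations; so if
-- two points x, y have a common i-successor, then R_i(x) = R_i(y), because the unique
-- g-successor of y (g = r(y, x)) is x.  The i-successor sets R_i(u) therefore partition
-- X into blocks of size k_i.  If p ∤ |X| then p ∤ k_i for every i, so S_{p'} = S and
-- both claims are immediate.
module Submission where

open import Defs
open import Algebra.Properties.CommutativeSemigroup using (interchange)
open import Data.Bool using (Bool; true; false; _∧_; not; if_then_else_)
open import Data.Bool.Properties using (not-¬)
open import Data.Empty using (⊥-elim)
open import Data.Fin using (Fin; _≟_)
import Data.Fin as F
open import Data.Fin.Subset using (Subset; _∈_)
open import Data.Nat using (ℕ; suc; zero; _+_; _<_; _≤_; z≤n; s≤s)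
open import Data.Nat.Divisibility using (_∣_; ∣-refl; ∣-trans; _∣0; ∣m∣n⇒∣m+n)
open import Data.Nat.Induction using (<-wellFounded)
open import Data.Nat.Primality using (Prime)
open import Data.Nat.Properties using (+-commutativeSemigroup; +-mono-≤; m<n+m; <⇒≢)
open import Data.Product using (_×_; _,_; proj₁; proj₂; ∃-syntax)
open import Induction.WellFounded using (Acc; acc)
open import Relation.Nullary using (¬_; yes; no)
open import Relation.Nullary.Decidable using (⌊_⌋)
open import Relation.Binary.PropositionalEquality

≟-true : ∀ {m} {a b : Fin m} → a ≡ b → ⌊ a ≟ b ⌋ ≡ true
≟-true {a = a} {b} a≡b with a ≟ b
... | yes _ = refl
... | no a≢b = ⊥-elim (a≢b a≡b)

≟-true⁻¹ : ∀ {m} {a b : Fin m} → ⌊ a ≟ b ⌋ ≡ true → a ≡ b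
≟-true⁻¹ {a = a} {b} t with a ≟ b
... | yes a≡b = a≡b

≟-false : ∀ {m} {a b : Fin m} → a ≢ b → ⌊ a ≟ b ⌋ ≡ false
≟-false {a = a} {b} a≢b with a ≟ b
... | yes a≡b = ⊥-elim (a≢b a≡b)
... | no _ = refl

∧-true : ∀ {x y} → x ≡ true → y ≡ true → x ∧ y ≡ true
∧-true refl refl = refl

∧-true⁻¹ : ∀ {x y} → x ∧ y ≡ true → x ≡ true × y ≡ true
∧-true⁻¹ {true} {true} refl = refl , refl

count-cong : ∀ {n} {f g : Fin n → Bool} → (∀ z → f z ≡ g z) → count f ≡ count g
count-cong {zero} f≗g = refl
count-cong {suc n} f≗g =
  cong₂ _+_ (cong (λ b → if b then 1 else 0) (f≗g F.zero)) (count-cong (λ z → f≗g (F.suc z)))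

count-all : ∀ n → count {n} (λ _ → true) ≡ n
count-all zero = refl
count-all (suc n) = cong suc (count-all n)

count-pos : ∀ {n} (f : Fin n → Bool) {b} → f b ≡ true → 0 < count f
count-pos f {F.zero} fb rewrite fb = s≤s z≤n
count-pos f {F.suc b} fb with f F.zero
... | true = s≤s z≤n
... | false = count-pos (λ z → f (F.suc z)) fb

count-pos⁻¹ : ∀ {n} (f : Fin n → Bool) → 0 < count f → ∃[ b ] f b ≡ true
count-pos⁻¹ {suc n} f pos with f F.zero in f0
... | true = F.zero , f0
... | false with count-pos⁻¹ (λ z → f (F.suc z)) pos
... | b , fb = F.suc b , fb

indicator-split : ∀ b q → (if b then 1 else 0) ≡ (if b ∧ q then 1 else 0) + (if b ∧ not q then 1 else 0)
indicator-split true true = refl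
indicator-split true false = refl
indicator-split false q = refl

count-split : ∀ {n} (f q : Fin n → Bool) →
  count f ≡ count (λ z → f z ∧ q z) + count (λ z → f z ∧ not (q z))
count-split {zero} f q = refl
count-split {suc n} f q =
  trans (cong₂ _+_ (indicator-split (f F.zero) (q F.zero))
                   (count-split (λ z → f (F.suc z)) (λ z → q (F.suc z))))
        (interchange +-commutativeSemigroup
          (if f F.zero ∧ q F.zero then 1 else 0) (if f F.zero ∧ not (q F.zero) then 1 else 0)
          (count (λ z → f (F.suc z) ∧ q (F.suc z))) (count (λ z → f (F.suc z) ∧ not (q (F.suc z)))))

count≡1⇒unique : ∀ {n} (f : Fin n → Bool) {b b′} →
  count f ≡ 1 → f b ≡ true → f b′ ≡ true → b ≡ b′
count≡1⇒unique f {b} {b′} one fb fb′ with b ≟ b′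
... | yes b≡b′ = b≡b′
... | no b≢b′ = ⊥-elim (<⇒≢ two≤count (sym one))
  where
  two≤count : 2 ≤ count f
  two≤count = subst (2 ≤_) (sym (count-split f (λ z → ⌊ z ≟ b ⌋)))
    (+-mono-≤ (count-pos (λ z → f z ∧ ⌊ z ≟ b ⌋) (∧-true fb (≟-true refl)))
              (count-pos (λ z → f z ∧ not ⌊ z ≟ b ⌋)
                         (∧-true fb′ (cong not (≟-false (λ b′≡b → b≢b′ (sym b′≡b)))))))

module BlockPartition {n : ℕ} (block : Fin n → Fin n → Bool) (k : ℕ)
  (block-size : ∀ w → count (block w) ≡ k)
  (block-self : ∀ w → block w w ≡ true)
  (block-overlap : ∀ w w′ a b →
     block w a ≡ true → block w′ a ≡ true → block w b ≡ true → block w′ b ≡ true) where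

  BlockClosed : (Fin n → Bool) → Set
  BlockClosed P = ∀ a b → P a ≡ true → block a b ≡ true → P b ≡ true

  _∖block_ : (Fin n → Bool) → Fin n → Fin n → Bool
  (P ∖block w) z = P z ∧ not (block w z)

  count-∖block : ∀ P {w} → BlockClosed P → P w ≡ true → count P ≡ k + count (P ∖block w)
  count-∖block P {w} closed Pw =
    trans (count-split P (block w)) (cong (_+ count (P ∖block w)) (trans (count-cong inside) (block-size w)))
    where
    inside : ∀ z → P z ∧ block w z ≡ block w z
    inside z with block w z in wz
    ... | true = cong (_∧ true) (closed w z Pw wz)
    ... | false with P z
    ... | true = refl
    ... | false = refl

  ∖block-closed : ∀ P {w} → BlockClosed P → BlockClosed (P ∖block w)
  ∖block-closed P {w} closed a b P∖a ab with ∧-true⁻¹ P∖a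
  ... | Pa , a∉w with block w b in wb
  ... | true = ⊥-elim (not-¬ (sym (block-overlap a w b a ab wb (block-self a))) (sym a∉w))
  ... | false = cong (_∧ true) (closed a b Pa ab)

  size∣closed : ∀ P → BlockClosed P → Acc _<_ (count P) → k ∣ count P
  size∣closed P closed (acc rec) with count P in c
  ... | zero = k ∣0
  ... | suc m with count-pos⁻¹ P (subst (0 <_) (sym c) (s≤s z≤n))
  ... | w , Pw = subst (k ∣_) (trans (sym split) c)
        (∣m∣n⇒∣m+n ∣-refl (size∣closed (P ∖block w) (∖block-closed P closed)
                             (rec smaller)))
    where
    split : count P ≡ k + count (P ∖block w)
    split = count-∖block P closed Pw
    smaller : count (P ∖block w) < suc m
    smaller = subst (count (P ∖block w) <_) (trans (sym split) c)
      (m<n+m _ (subst (0 <_) (block-size w) (count-pos (block w) (block-self w))))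

  size∣order : k ∣ n
  size∣order = subst (k ∣_) (count-all n) (size∣closed _ (λ _ _ _ _ → refl) (<-wellFounded _))

module SchemeProperties {n d : ℕ} (S : AssocScheme n d) where
  open AssocScheme S

  tr-involutive : ∀ i → tr (tr i) ≡ i
  tr-involutive i with nonempty i
  ... | x , y , xy = trans (sym (tr-spec (tr i) y x (tr-spec i x y xy))) xy

  via : Fin (suc d) → Fin (suc d) → Fin n → Fin n → Fin n → Bool
  via i j x y z = ⌊ rel x z ≟ i ⌋ ∧ ⌊ rel z y ≟ j ⌋

  pn-pos : ∀ {i j k x y z} → rel x y ≡ k → rel x z ≡ i → rel z y ≡ j → 0 < pn i j k
  pn-pos {i} {j} {k} {x} {y} xy xz zy =
    subst (0 <_) (pn-spec i j k x y xy) (count-pos (via i j x y) (∧-true (≟-true xz) (≟-true zy)))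

  pn-pos⁻¹ : ∀ {i j k x y} → 0 < pn i j k → rel x y ≡ k → ∃[ z ] rel x z ≡ i × rel z y ≡ j
  pn-pos⁻¹ {i} {j} {k} {x} {y} pos xy with count-pos⁻¹ (via i j x y) (subst (0 <_) (sym (pn-spec i j k x y xy)) pos)
  ... | z , path with ∧-true⁻¹ path
  ... | xz , zy = z , ≟-true⁻¹ xz , ≟-true⁻¹ zy

  count-successors : ∀ i x → count (λ z → ⌊ rel x z ≟ i ⌋) ≡ valency S i
  count-successors i x = trans (count-cong back-and-forth) (pn-spec i (tr i) F.zero x x (diagonal′ x))
    where
    back-and-forth : ∀ z → ⌊ rel x z ≟ i ⌋ ≡ ⌊ rel x z ≟ i ⌋ ∧ ⌊ rel z x ≟ tr i ⌋
    back-and-forth z with rel x z ≟ i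
    ... | yes xz = sym (≟-true (tr-spec i x z xz))
    ... | no _ = refl

  has-predecessor : ∀ i w → ∃[ u ] rel u w ≡ i
  has-predecessor i w with nonempty i
  ... | x , y , xy with pn-pos⁻¹ (pn-pos (diagonal′ y) (tr-spec i x y xy) xy) (diagonal′ w)
  ... | u , _ , uw = u , uw

  thin-functional : ∀ {g a b b′} → InOLower S g → rel a b ≡ g → rel a b′ ≡ g → b ≡ b′
  thin-functional {g} {a} one ab ab′ =
    count≡1⇒unique (λ z → ⌊ rel a z ≟ g ⌋) (trans (count-successors g a) one) (≟-true ab) (≟-true ab′)

  R₀∈closed : ∀ T → Closed S T → F.zero ∈ T
  R₀∈closed T ((t , t∈T) , closed) with nonempty t
  ... | a , b , ab = closed t t F.zero t∈T t∈T (pn-pos (diagonal′ b) (tr-spec t a b ab) ab)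

  common-successor∈OUpper : ∀ {i x y z} → rel x z ≡ i → rel y z ≡ i → InOUpper S (rel y x)
  common-successor∈OUpper {i} {x} {y} {z} xz yz T (closed , normal) =
    normal (tr i) F.zero i (rel y x) (R₀∈closed T closed)
      (subst (λ j → 0 < pn j F.zero i) (sym (tr-involutive i)) (pn-pos yz yz (diagonal′ z)))
      (pn-pos refl yz (tr-spec i x z xz))

  module _ (thin-residue : ∀ k → InOUpper S k → InOLower S k) where

    common-successor⇒same-successors : ∀ {i x y z c} →
      rel x z ≡ i → rel y z ≡ i → rel y c ≡ i → rel x c ≡ i
    common-successor⇒same-successors {i} {x} {y} {z} {c} xz yz yc
      with pn-pos⁻¹ (pn-pos yz refl xz) yc
    ... | u , yu , uc = subst (λ v → rel v c ≡ i) u≡x uc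
      where
      u≡x : u ≡ x
      u≡x = thin-functional (thin-residue _ (common-successor∈OUpper xz yz)) yu refl

    valency∣order : ∀ i → valency S i ∣ n
    valency∣order i = size∣order
      where
      source : Fin n → Fin n
      source w = proj₁ (has-predecessor i w)
      open BlockPartition (λ w b → ⌊ rel (source w) b ≟ i ⌋) (valency S i)
        (λ w → count-successors i (source w))
        (λ w → ≟-true (proj₂ (has-predecessor i w)))
        (λ w w′ a b wa w′a wb → ≟-true (common-successor⇒same-successors
           (≟-true⁻¹ w′a) (≟-true⁻¹ wa) (≟-true⁻¹ wb)))

corollary4p5 : (p n d : ℕ) → Prime p → (S : AssocScheme n d) →
    (∀ k → InOUpper S k → InOLower S k) →
    ¬ (p ∣ n) →
    (∀ k → InGenerated S (InSp′ S p) k) ×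
    (∀ (T : Subset (suc d)) → Closed S T → (∀ i → InSp′ S p i → i ∈ T) →
    ∀ k → k ∈ T)
corollary4p5 p n d _ S thin-residue p∤n =
  (λ k T _ Sp′⊆T → Sp′⊆T k (every-Sp′ k)) , (λ T _ Sp′⊆T k → Sp′⊆T k (every-Sp′ k))
  where
  every-Sp′ : ∀ i → InSp′ S p i
  every-Sp′ i p∣kᵢ = p∤n (∣-trans p∣kᵢ (SchemeProperties.valency∣order S thin-residue i))
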